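{- For every Clobber configuration $C$ and every configuration $C'$ obtained from $C$ by an arbitrary finite sequence of legal moves (not necessarily alternating in color), $\delta(C')\equiv \delta(C) \pmod 3$.
   Context: Clobber is played with black and white stones occupying some squares of a grid board whose squares are colored black and white in a checkerboard pattern. A move consists of picking up a stone and moving it onto a horizontally or vertically adjacent square occupied by a stone of the opposite color; that stone is removed and replaced by the moved stone. A stone is matching if its color equals the color of the square it occupies, and clashing otherwise. For a configuration $C$, $\delta(C)$ denotes the number of stones of $C$ plus the number of clashing stones of $C$. -}

module Defs where

open import Data.Nat using (ℕ; zero; suc; _+_)
open import Data.Nat.DivMod using (_%_)
open import Data.Bool using (Bool; true; false; not; if_then_else_)
open import Data.Fin using (Fin; toℕ)
open import Data.Fin.Properties using (_≟_)
open import Data.Maybe using (Maybe; just; nothing)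
open import Data.Product using (_×_; _,_; Σ; ∃)
open import Data.Sum using (_⊎_)
open import Data.List using (List; map; allFin)
open import Data.Nat.ListAction using (sum)
open import Relation.Binary.PropositionalEquality using (_≡_; _≢_)
open import Relation.Nullary using (does)
open import Relation.Binary.Construct.Closure.ReflexiveTransitive using (Star)

data Colour : Set where
  black white : Colour

opp : Colour → Colour
opp black = white
opp white = black

Square : ℕ → ℕ → Set
Square m n = Fin m × Fin n

squareColour : ∀ {m n} → Square m n → Colour
squareColour (i , j) with (toℕ i + toℕ j) % 2
... | zero = black
... | suc _ = white

Config : ℕ → ℕ → Set
Config m n = Square m n → Maybe Colour

data Adjacent {m n : ℕ} : Square m n → Square m n → Set where
  right : ∀ {i j k} → toℕ k ≡ suc (toℕ j) → Adjacent (i , j) (i , k)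
  left  : ∀ {i j k} → toℕ j ≡ suc (toℕ k) → Adjacent (i , j) (i , k)
  down  : ∀ {i k j} → toℕ k ≡ suc (toℕ i) → Adjacent (i , j) (k , j)
  up    : ∀ {i k j} → toℕ i ≡ suc (toℕ k) → Adjacent (i , j) (k , j)

sqEq : ∀ {m n} → Square m n → Square m n → Bool
sqEq (i , j) (k , l) with does (i ≟ k) | does (j ≟ l)
... | true | true = true
... | _ | _ = false

moveResult : ∀ {m n} → Config m n → Square m n → Square m n → Config m n
moveResult C s t x =
  if sqEq x t then C s else (if sqEq x s then nothing else C x)

data Move {m n : ℕ} : Config m n → Config m n → Set where
  move : (C : Config m n) (s t : Square m n) (c : Colour) →
         Adjacent s t → C s ≡ just c → C t ≡ just (opp c) →
         Move C (moveResult C s t)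

Reachable : ∀ {m n} → Config m n → Config m n → Set
Reachable = Star Move

colourEq : Colour → Colour → Bool
colourEq black black = true
colourEq white white = true
colourEq _ _ = false

weight : ∀ {m n} → Config m n → Square m n → ℕ
weight C x with C x
... | nothing = 0
... | just c = if colourEq c (squareColour x) then 1 else 2

squares : (m n : ℕ) → List (Square m n)
squares m n = Data.List.concatMap (λ i → map (λ j → i , j) (allFin n)) (allFin m)

-- δ(C) = number of stones + number of clashing stones.
δ : ∀ {m n} → Config m n → ℕ
δ {m} {n} C = sum (map (weight C) (squares m n))

{-# OPTIONS --safe #-}
module Submission where

-- A move of a stone of colour c from s onto the adjacent square t changes the
-- configuration only at s and t, and s, t have opposite square colours.  So the
-- captured stone (colour opp c on t) matches exactly when the moving stone (c on
-- s) does, while the moved stone (c on t) does the opposite.  If the mover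
-- matched, δ loses 1 + 1 and gains 2; otherwise it loses 2 + 2 and gains 1.
-- Either way δ drops by 0 or 3.

open import Defs
open import Algebra.Properties.CommutativeSemigroup using (interchange)
open import Data.Bool using (true; false; _∧_; if_then_else_)
open import Data.Bool.Properties using (¬-not)
open import Data.Fin using (Fin; toℕ; zero; suc)
open import Data.Fin.Properties using (_≟_)
open import Data.List using (List; []; _∷_; _++_; map; allFin; concatMap; tabulate)
open import Data.List.Properties using (map-cong; map-∘; map-++; map-tabulate)
open import Data.Maybe using (Maybe; just; nothing)
open import Data.Nat using (ℕ; zero; suc; _+_)
open import Data.Nat.DivMod using (_%_; [m+n]%n≡m%n)
open import Data.Nat.ListAction using (sum)
open import Data.Nat.ListAction.Properties using (sum-++)
open import Data.Nat.Properties using (+-assoc; +-comm; +-identityʳ; +-suc; +-cancelʳ-≡; +-commutativeSemigroup)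
open import Data.Product using (_,_)
open import Data.Sum using (_⊎_; inj₁; inj₂)
open import Function using (_∘_; id)
open import Relation.Nullary using (does; yes; no)
open import Relation.Binary.PropositionalEquality
open import Relation.Binary.Construct.Closure.ReflexiveTransitive using (ε; _◅_)

module _ {A : Set} where

  sum-map-+ : (f g : A → ℕ) (xs : List A) →
              sum (map (λ x → f x + g x) xs) ≡ sum (map f xs) + sum (map g xs)
  sum-map-+ f g []       = refl
  sum-map-+ f g (x ∷ xs) =
    trans (cong (f x + g x +_) (sum-map-+ f g xs))
          (interchange +-commutativeSemigroup (f x) (g x) _ _)

  sum-map-const-0 : (xs : List A) → sum (map (λ _ → 0) xs) ≡ 0
  sum-map-const-0 []       = refl
  sum-map-const-0 (x ∷ xs) = sum-map-const-0 xs

  sum-map-concatMap : {B : Set} (f : B → ℕ) (g : A → List B) (xs : List A) →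
                      sum (map f (concatMap g xs)) ≡ sum (map (λ x → sum (map f (g x))) xs)
  sum-map-concatMap f g []       = refl
  sum-map-concatMap f g (x ∷ xs) = begin
    sum (map f (g x ++ concatMap g xs))               ≡⟨ cong sum (map-++ f (g x) _) ⟩
    sum (map f (g x) ++ map f (concatMap g xs))       ≡⟨ sum-++ (map f (g x)) _ ⟩
    sum (map f (g x)) + sum (map f (concatMap g xs))  ≡⟨ cong (sum (map f (g x)) +_) (sum-map-concatMap f g xs) ⟩
    sum (map f (g x)) + sum (map (λ x → sum (map f (g x))) xs) ∎
    where open ≡-Reasoning

sum-tabulate-if-≟ : ∀ {n} (k : Fin n) (a : ℕ) → sum (tabulate (λ j → if does (j ≟ k) then a else 0)) ≡ a
sum-tabulate-if-≟ {suc n} zero a = begin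
  a + sum (tabulate {n = n} (λ _ → 0))  ≡⟨ cong (a +_) (cong sum (map-tabulate {n = n} id (λ _ → 0))) ⟨
  a + sum (map (λ _ → 0) (allFin n))    ≡⟨ cong (a +_) (sum-map-const-0 (allFin n)) ⟩
  a + 0                                 ≡⟨ +-identityʳ a ⟩
  a                                     ∎
  where open ≡-Reasoning
sum-tabulate-if-≟ {suc n} (suc k) a = sum-tabulate-if-≟ k a

sum-allFin-if-≟ : ∀ {n} (k : Fin n) (a : ℕ) → sum (map (λ j → if does (j ≟ k) then a else 0) (allFin n)) ≡ a
sum-allFin-if-≟ {n} k a =
  trans (cong sum (map-tabulate {n = n} id (λ j → if does (j ≟ k) then a else 0))) (sum-tabulate-if-≟ k a)

sqEq≡∧ : ∀ {m n} (i k : Fin m) (j l : Fin n) → sqEq (i , j) (k , l) ≡ does (i ≟ k) ∧ does (j ≟ l)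
sqEq≡∧ i k j l with does (i ≟ k) | does (j ≟ l)
... | true  | true  = refl
... | true  | false = refl
... | false | _     = refl

sqEq-sound : ∀ {m n} (x y : Square m n) → sqEq x y ≡ true → x ≡ y
sqEq-sound (i , j) (k , l) eq with i ≟ k | j ≟ l
sqEq-sound _ _ () | yes _ | no _
sqEq-sound _ _ () | no _  | _
... | yes refl | yes refl = refl

sqEq-false : ∀ {m n} {x y : Square m n} → x ≢ y → sqEq x y ≡ false
sqEq-false {x = x} {y} x≢y = ¬-not (x≢y ∘ sqEq-sound x y)

pointMass : ∀ {m n} → Square m n → ℕ → Square m n → ℕ
pointMass y a x = if sqEq x y then a else 0

sum-squares-pointMass : ∀ {m n} (y : Square m n) (a : ℕ) → sum (map (pointMass y a) (squares m n)) ≡ a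
sum-squares-pointMass {m} {n} (k , l) a = begin
  sum (map (pointMass (k , l) a) (squares m n))
    ≡⟨ sum-map-concatMap (pointMass (k , l) a) (λ i → map (i ,_) (allFin n)) (allFin m) ⟩
  sum (map (λ i → sum (map (pointMass (k , l) a) (map (i ,_) (allFin n)))) (allFin m))
    ≡⟨ cong sum (map-cong row (allFin m)) ⟩
  sum (map (λ i → if does (i ≟ k) then a else 0) (allFin m))
    ≡⟨ sum-allFin-if-≟ k a ⟩
  a ∎
  where
  open ≡-Reasoning
  row : ∀ i → sum (map (pointMass (k , l) a) (map (i ,_) (allFin n))) ≡ (if does (i ≟ k) then a else 0)
  row i = begin
    sum (map (pointMass (k , l) a) (map (i ,_) (allFin n)))
      ≡⟨ cong sum (map-∘ (allFin n)) ⟨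
    sum (map (λ j → pointMass (k , l) a (i , j)) (allFin n))
      ≡⟨ cong sum (map-cong (λ j → cong (if_then a else 0) (sqEq≡∧ i k j l)) (allFin n)) ⟩
    sum (map (λ j → if does (i ≟ k) ∧ does (j ≟ l) then a else 0) (allFin n))
      ≡⟨ split (does (i ≟ k)) ⟩
    (if does (i ≟ k) then a else 0) ∎
    where
    split : ∀ b → sum (map (λ j → if b ∧ does (j ≟ l) then a else 0) (allFin n)) ≡ (if b then a else 0)
    split true  = sum-allFin-if-≟ l a
    split false = sum-map-const-0 (allFin n)

matchWeight : Colour → Colour → ℕ
matchWeight c d = if colourEq c d then 1 else 2

stoneWeight : ∀ {m n} → Maybe Colour → Square m n → ℕ
stoneWeight nothing  x = 0
stoneWeight (just c) x = matchWeight c (squareColour x)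

weight≡stoneWeight : ∀ {m n} (C : Config m n) (x : Square m n) → weight C x ≡ stoneWeight (C x) x
weight≡stoneWeight C x with C x
... | nothing = refl
... | just c  = refl

weight-moveResult : ∀ {m n} (C : Config m n) {s t : Square m n} → t ≢ s → ∀ x →
  weight (moveResult C s t) x + (pointMass s (weight C s) x + pointMass t (weight C t) x)
    ≡ weight C x + pointMass t (stoneWeight (C s) t) x
weight-moveResult C {s} {t} t≢s x rewrite weight≡stoneWeight (moveResult C s t) x with sqEq x t in x≟t
... | true with refl ← sqEq-sound x t x≟t rewrite sqEq-false t≢s = +-comm (stoneWeight (C s) t) (weight C t)
... | false with sqEq x s in x≟s
...   | true with refl ← sqEq-sound x s x≟s = refl
...   | false = cong (_+ 0) (sym (weight≡stoneWeight C x))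

δ-moveResult : ∀ {m n} (C : Config m n) {s t : Square m n} → t ≢ s →
  δ (moveResult C s t) + (weight C s + weight C t) ≡ δ C + stoneWeight (C s) t
δ-moveResult {m} {n} C {s} {t} t≢s = begin
  δ C′ + (weight C s + weight C t)
    ≡⟨ cong (δ C′ +_) (cong₂ _+_ (sum-squares-pointMass s _) (sum-squares-pointMass t _)) ⟨
  δ C′ + (Σ (pointMass s (weight C s)) + Σ (pointMass t (weight C t)))
    ≡⟨ cong (δ C′ +_) (sum-map-+ _ _ (squares m n)) ⟨
  δ C′ + Σ (λ x → pointMass s (weight C s) x + pointMass t (weight C t) x)
    ≡⟨ sum-map-+ _ _ (squares m n) ⟨
  Σ (λ x → weight C′ x + (pointMass s (weight C s) x + pointMass t (weight C t) x))
    ≡⟨ cong sum (map-cong (weight-moveResult C t≢s) (squares m n)) ⟩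
  Σ (λ x → weight C x + pointMass t (stoneWeight (C s) t) x)
    ≡⟨ sum-map-+ _ _ (squares m n) ⟩
  δ C + Σ (pointMass t (stoneWeight (C s) t))
    ≡⟨ cong (δ C +_) (sum-squares-pointMass t _) ⟩
  δ C + stoneWeight (C s) t ∎
  where
  open ≡-Reasoning
  C′ = moveResult C s t
  Σ : (Square m n → ℕ) → ℕ
  Σ f = sum (map f (squares m n))

remainderColour : ℕ → Colour
remainderColour zero    = black
remainderColour (suc _) = white

squareColour≡remainderColour : ∀ {m n} (i : Fin m) (j : Fin n) →
  squareColour (i , j) ≡ remainderColour ((toℕ i + toℕ j) % 2)
squareColour≡remainderColour i j with (toℕ i + toℕ j) % 2
... | zero  = refl
... | suc _ = refl

remainderColour-suc : ∀ k → remainderColour (suc k % 2) ≡ opp (remainderColour (k % 2))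
remainderColour-suc zero          = refl
remainderColour-suc (suc zero)    = refl
remainderColour-suc (suc (suc k)) = remainderColour-suc k

squareColour-right : ∀ {m n} (i : Fin m) {j k : Fin n} → toℕ k ≡ suc (toℕ j) →
  squareColour (i , k) ≡ opp (squareColour (i , j))
squareColour-right i {j} {k} k≡1+j
  rewrite squareColour≡remainderColour i k | squareColour≡remainderColour i j | k≡1+j | +-suc (toℕ i) (toℕ j)
  = remainderColour-suc (toℕ i + toℕ j)

squareColour-down : ∀ {m n} {i k : Fin m} (j : Fin n) → toℕ k ≡ suc (toℕ i) →
  squareColour (k , j) ≡ opp (squareColour (i , j))
squareColour-down {i = i} {k} j k≡1+i
  rewrite squareColour≡remainderColour k j | squareColour≡remainderColour i j | k≡1+i
  = remainderColour-suc (toℕ i + toℕ j)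

opp-flip : ∀ {c d} → c ≡ opp d → d ≡ opp c
opp-flip {black} {white} refl = refl
opp-flip {white} {black} refl = refl

c≢opp-c : ∀ {c} → c ≢ opp c
c≢opp-c {black} ()
c≢opp-c {white} ()

Adjacent⇒squareColour-opp : ∀ {m n} {s t : Square m n} → Adjacent s t → squareColour t ≡ opp (squareColour s)
Adjacent⇒squareColour-opp (right {i} k≡1+j)   = squareColour-right i k≡1+j
Adjacent⇒squareColour-opp (left {i} j≡1+k)    = opp-flip (squareColour-right i j≡1+k)
Adjacent⇒squareColour-opp (down {j = j} k≡1+i) = squareColour-down j k≡1+i
Adjacent⇒squareColour-opp (up {j = j} i≡1+k)   = opp-flip (squareColour-down j i≡1+k)

Adjacent⇒≢ : ∀ {m n} {s t : Square m n} → Adjacent s t → t ≢ s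
Adjacent⇒≢ adj refl = c≢opp-c (Adjacent⇒squareColour-opp adj)

matchWeight-capture : ∀ c d →
  let lost = matchWeight c d + matchWeight (opp c) (opp d) in
  lost ≡ matchWeight c (opp d) ⊎ lost ≡ matchWeight c (opp d) + 3
matchWeight-capture black black = inj₁ refl
matchWeight-capture black white = inj₂ refl
matchWeight-capture white black = inj₂ refl
matchWeight-capture white white = inj₁ refl

capture-weights : ∀ {m n} {C : Config m n} {s t : Square m n} {c : Colour} →
  Adjacent s t → C s ≡ just c → C t ≡ just (opp c) →
  let lost = weight C s + weight C t in
  lost ≡ stoneWeight (C s) t ⊎ lost ≡ stoneWeight (C s) t + 3
capture-weights {C = C} {s} {t} {c} adj Cs≡c Ct≡c′
  rewrite weight≡stoneWeight C s | weight≡stoneWeight C t | Cs≡c | Ct≡c′ | Adjacent⇒squareColour-opp adj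
  = matchWeight-capture c (squareColour s)

Move⇒δ-drop : ∀ {m n} {C C′ : Config m n} → Move C C′ → δ C ≡ δ C′ ⊎ δ C ≡ δ C′ + 3
Move⇒δ-drop (move C s t c adj Cs≡c Ct≡c′) =
  cancel (δ-moveResult C (Adjacent⇒≢ adj)) (capture-weights adj Cs≡c Ct≡c′)
  where
  cancel : ∀ {a b c k} → a + b ≡ c + k → b ≡ k ⊎ b ≡ k + 3 → c ≡ a ⊎ c ≡ a + 3
  cancel {a} {c = c} {k} eq (inj₁ refl) = inj₁ (sym (+-cancelʳ-≡ k a c eq))
  cancel {a} {c = c} {k} eq (inj₂ refl) =
    inj₂ (sym (+-cancelʳ-≡ k (a + 3) c (trans (+-assoc a 3 k) (trans (cong (a +_) (+-comm 3 k)) eq))))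

Move⇒δ%3 : ∀ {m n} {C C′ : Config m n} → Move C C′ → δ C′ % 3 ≡ δ C % 3
Move⇒δ%3 {C′ = C′} mv with Move⇒δ-drop mv
... | inj₁ δC≡δC′   = cong (_% 3) (sym δC≡δC′)
... | inj₂ δC≡δC′+3 = trans (sym ([m+n]%n≡m%n (δ C′) 3)) (cong (_% 3) (sym δC≡δC′+3))

theorem3 : (m n : ℕ) (C C′ : Config m n) → Reachable C C′ →
    δ C′ % 3 ≡ δ C % 3
theorem3 m n C .C ε = refl
theorem3 m n C C′ (mv ◅ mvs) = trans (theorem3 m n _ C′ mvs) (Move⇒δ%3 mv)
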